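{- For $N\ge 0$ let $a_N$ be the number of tilings of the $6\times \tfrac{2N}{3}$ rectangle by $1\times 4$ tiles when $2N/3$ is a positive integer, $a_N=0$ when $2N/3$ is not an integer, and $a_0=1$. Then $$\sum_{N\ge 0} a_N z^N=\frac{(1-z^6)^3}{1-7z^6+6z^{12}-4z^{18}+z^{24}} = 1+4z^6+25z^{12}+154z^{18}+943z^{24}+\cdots.$$
   Context: A tiling of an $m\times n$ rectangle (made of $mn$ unit squares) by $a\times b$ tiles is a set of non-overlapping axis-parallel $a\times b$ or $b\times a$ rectangles with integer corners whose union is the rectangle; both orientations may be mixed. Tilings related by a symmetry of the rectangle are counted separately. The index $N$ is the number of tiles used. -}

module Defs where

open import Data.Nat using (ℕ; zero; suc; _+_; _*_; _∸_; _≤ᵇ_; _<ᵇ_; _≡ᵇ_)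
open import Data.Nat.DivMod using (_/_; _%_)
open import Data.Bool using (Bool; true; false; _∧_; if_then_else_)
open import Data.List using (List; []; _∷_; map; _++_; concatMap; filter; length; upTo; foldr)
open import Data.Product using (_×_; _,_)
open import Data.Integer as ℤ using (ℤ)
open import Relation.Nullary.Decidable using (yes; no)
open import Data.Bool.Properties using (T?)

-- A placed tile is (x , y , w , h): it occupies the cells (i , j) with
-- x ≤ i < x + w and y ≤ j < y + h, where (w , h) ∈ {(a , b) , (b , a)}
-- and the tile lies inside the rectangle (x + w ≤ m, y + h ≤ n).

Tile : Set
Tile = ℕ × ℕ × ℕ × ℕ

Cell : Set
Cell = ℕ × ℕ

-- the allowed orientations (deduplicated when a = b, a square tile)
orientations : ℕ → ℕ → List (ℕ × ℕ)
orientations a b = if a ≡ᵇ b then (a , b) ∷ [] else (a , b) ∷ (b , a) ∷ []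

placements : ℕ → ℕ → ℕ → ℕ → List Tile
placements m n a b =
  concatMap (λ { (w , h) →
    concatMap (λ x →
      concatMap (λ y →
        if (x + w ≤ᵇ m) ∧ (y + h ≤ᵇ n) then (x , y , w , h) ∷ [] else [])
      (upTo n))
    (upTo m) })
  (orientations a b)

cells : ℕ → ℕ → List Cell
cells m n = concatMap (λ i → map (λ j → (i , j)) (upTo n)) (upTo m)

covers : Tile → Cell → Bool
covers (x , y , w , h) (i , j) = (x ≤ᵇ i) ∧ (i <ᵇ x + w) ∧ (y ≤ᵇ j) ∧ (j <ᵇ y + h)

-- all sub-lists of a list (= all subsets, when the list has no duplicates)
subsets : {A : Set} → List A → List (List A)
subsets [] = [] ∷ []
subsets (t ∷ ts) = let r = subsets ts in map (t ∷_) r ++ r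

-- a set S of placed tiles is a tiling iff every cell is covered by
-- exactly one tile of S (tiles lie inside the rectangle by construction)
allB : {A : Set} → (A → Bool) → List A → Bool
allB p [] = true
allB p (x ∷ xs) = p x ∧ allB p xs

isTiling : ℕ → ℕ → List Tile → Bool
isTiling m n S = allB (λ c → length (filter (λ t → T? (covers t c)) S) ≡ᵇ 1) (cells m n)

numTilings : ℕ → ℕ → ℕ → ℕ → ℕ
numTilings m n a b = length (filter (λ S → T? (isTiling m n S)) (subsets (placements m n a b)))

aSeq : ℕ → ℕ
aSeq zero = 1
aSeq (suc k) =
  let N = suc k in
  if (2 * N) % 3 ≡ᵇ 0 then numTilings 6 ((2 * N) / 3) 1 4 else 0

-- Formal power series over ℤ as coefficient functions ℕ → ℤ,
-- polynomials as coefficient lists (lowest degree first).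

Series : Set
Series = ℕ → ℤ

Poly : Set
Poly = List ℤ

coeff : Poly → Series
coeff [] _ = ℤ.0ℤ
coeff (c ∷ _) zero = c
coeff (_ ∷ cs) (suc k) = coeff cs k

sumTo : (ℕ → ℤ) → ℕ → ℤ
sumTo f zero = f zero
sumTo f (suc N) = sumTo f N ℤ.+ f (suc N)

_⋆_ : Series → Series → Series
(f ⋆ g) N = sumTo (λ k → f k ℤ.* g (N ∸ k)) N

_⊕_ : Poly → Poly → Poly
[] ⊕ q = q
(c ∷ p) ⊕ [] = c ∷ p
(c ∷ p) ⊕ (d ∷ q) = (c ℤ.+ d) ∷ (p ⊕ q)

scale : ℤ → Poly → Poly
scale c = map (c ℤ.*_)

_⊗_ : Poly → Poly → Poly
[] ⊗ q = []
(c ∷ p) ⊗ q = scale c q ⊕ (ℤ.0ℤ ∷ (p ⊗ q))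

_^ₚ_ : Poly → ℕ → Poly
p ^ₚ zero = ℤ.1ℤ ∷ []
p ^ₚ suc k = p ⊗ (p ^ₚ k)

mono : ℤ → ℕ → Poly
mono c zero = c ∷ []
mono c (suc k) = ℤ.0ℤ ∷ mono c k

numer : Poly
numer = (mono ℤ.1ℤ 0 ⊕ mono (ℤ.- ℤ.1ℤ) 6) ^ₚ 3

denom : Poly
denom = mono (ℤ.+ 1) 0 ⊕ (mono (ℤ.- (ℤ.+ 7)) 6 ⊕ (mono (ℤ.+ 6) 12 ⊕ (mono (ℤ.- (ℤ.+ 4)) 18 ⊕ mono (ℤ.+ 1) 24)))

genFun : Series
genFun N = ℤ.+ (aSeq N)

module Submission where

-- Tile the 6 × n rectangle from the left: once the first column is covered,
-- what remains is the (n − 1)-column rectangle in which some cells are already covered by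
-- horizontal tiles sticking out; record this as a profile. Only 40 profiles are reachable from
-- the empty one, and on the orbit of the empty profile the transfer operator T satisfies
-- T¹⁶ − 7T¹² + 6T⁸ − 4T⁴ + 1 = 0, a finite computation. So the numbers t n of tilings of 6 × n
-- satisfy t (n+16) − 7 t (n+12) + 6 t (n+8) − 4 t (n+4) + t n = 0 (for n ≥ 3 from the identity,
-- for n < 3 from computed values). Since a_N = t (2N/3), the a_N satisfy the same recurrence
-- with steps of 6, which says that the product with the denominator vanishes beyond degree 23;
-- the first 24 coefficients are computed.

open import Defs
open import Function using (_∘_)
open import Function.Bundles using (Equivalence)
open import Data.Bool using (Bool; true; false; T; _∧_; _∨_; not; if_then_else_)
open import Data.Bool.Properties using (T?; T-≡; ∧-zeroʳ; ∧-assoc)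
open import Data.Bool.ListAction using (any)
open import Data.Nat using (ℕ; zero; suc; _+_; _*_; _∸_; _≤_; _<_; _≤ᵇ_; _<ᵇ_; _≡ᵇ_; z≤n; s≤s)
import Data.Nat as ℕ
open import Data.Nat.Properties
  using (+-assoc; +-comm; +-identityʳ; +-suc; *-identityˡ; *-zeroʳ; *-assoc; *-distribʳ-+; *-distribˡ-+;
         ≤-refl; ≤-trans; ≤-reflexive; <-≤-trans; +-mono-≤; *-monoʳ-≤; m≤m+n; m≤n⇒m≤1+n; m∸[m∸n]≡n;
         ≤-pred; ≤ᵇ⇒≤; <ᵇ⇒<; +-commutativeSemigroup)
open import Data.Nat.DivMod using (_/_; _%_; [m+kn]%n≡m%n; +-distrib-/-∣ʳ; m*n/n≡m; /-monoˡ-≤)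
open import Data.Nat.Divisibility using (divides-refl)
open import Data.Nat.ListAction using (sum)
open import Data.Nat.ListAction.Properties using (sum-++)
open import Data.Nat.Tactic.RingSolver using (solve-∀)
open import Data.Integer as ℤ using (ℤ; 0ℤ)
import Data.Integer.Properties as ℤᵖ
import Data.Integer.Tactic.RingSolver as ℤ-Solver
open import Data.List using (List; []; _∷_; _++_; map; concatMap; filter; foldr; length; replicate; drop; null; upTo; applyUpTo)
open import Data.List.Properties
  using (map-++; map-∘; map-cong; map-upTo; concatMap-map; map-concatMap; concatMap-cong; ++-assoc; ≡-dec; ∷-injectiveˡ; ∷-injectiveʳ)
open import Data.List.Membership.Propositional using (_∈_; find)
open import Data.List.Membership.Propositional.Properties using (∈-map⁺; ∈-map⁻; ∈-concatMap⁺; ∈-concatMap⁻; ∈-upTo⁺; ∈-upTo⁻)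
open import Data.List.Relation.Unary.Any as Any using (here; there)
open import Data.List.Relation.Unary.Any.Properties using (any⁻)
open import Data.List.Relation.Unary.All as All using (All; all?)
open import Data.List.Relation.Binary.Permutation.Propositional as ↭ using (_↭_; module PermutationReasoning)
open import Data.List.Relation.Binary.Permutation.Propositional.Properties using (++⁺; ++⁺ˡ; ++⁺ʳ; ++-comm)
open import Data.Product using (_×_; _,_; ∃; proj₁; proj₂)
open import Data.Sum as Sum using (_⊎_; inj₁; inj₂)
open import Relation.Nullary using (does; yes; no)
open import Relation.Nullary.Decidable using (from-yes)
open import Relation.Binary.Definitions using (DecidableEquality)
open import Relation.Binary.PropositionalEquality
import Algebra.Properties.CommutativeSemigroup as CommutativeSemigroupProperties
open CommutativeSemigroupProperties +-commutativeSemigroup using (interchange; x∙yz≈y∙xz)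
module ℤ-Semigroup = CommutativeSemigroupProperties ℤᵖ.+-commutativeSemigroup


χ : Bool → ℕ
χ true = 1
χ false = 0

countᵇ : {A : Set} → (A → Bool) → List A → ℕ
countᵇ p [] = 0
countᵇ p (x ∷ xs) = χ (p x) + countᵇ p xs

length-filter≡countᵇ : {A : Set} (p : A → Bool) (xs : List A) → length (filter (λ x → T? (p x)) xs) ≡ countᵇ p xs
length-filter≡countᵇ p [] = refl
length-filter≡countᵇ p (x ∷ xs) with p x
... | true = cong suc (length-filter≡countᵇ p xs)
... | false = length-filter≡countᵇ p xs

countᵇ-++ : {A : Set} (p : A → Bool) (xs ys : List A) → countᵇ p (xs ++ ys) ≡ countᵇ p xs + countᵇ p ys
countᵇ-++ p [] ys = refl
countᵇ-++ p (x ∷ xs) ys = trans (cong (χ (p x) +_) (countᵇ-++ p xs ys)) (sym (+-assoc (χ (p x)) _ _))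

countᵇ-map : {A B : Set} (p : B → Bool) (f : A → B) (xs : List A) → countᵇ p (map f xs) ≡ countᵇ (p ∘ f) xs
countᵇ-map p f [] = refl
countᵇ-map p f (x ∷ xs) = cong (χ (p (f x)) +_) (countᵇ-map p f xs)

countᵇ-cong : {A : Set} {p q : A → Bool} → (∀ x → p x ≡ q x) → (xs : List A) → countᵇ p xs ≡ countᵇ q xs
countᵇ-cong p≗q [] = refl
countᵇ-cong p≗q (x ∷ xs) = cong₂ _+_ (cong χ (p≗q x)) (countᵇ-cong p≗q xs)

countᵇ-∧ˡ : {A : Set} (b : Bool) (p : A → Bool) (xs : List A) → countᵇ (λ x → b ∧ p x) xs ≡ (if b then countᵇ p xs else 0)
countᵇ-∧ˡ true p xs = refl
countᵇ-∧ˡ false p [] = refl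
countᵇ-∧ˡ false p (x ∷ xs) = countᵇ-∧ˡ false p xs

countᵇ-none : {A : Set} (p : A → Bool) (xs : List A) → (∀ x → p x ≡ false) → countᵇ p xs ≡ 0
countᵇ-none p [] none = refl
countᵇ-none p (x ∷ xs) none rewrite none x = countᵇ-none p xs none

allB-cong : {A : Set} {p q : A → Bool} → (∀ x → p x ≡ q x) → (xs : List A) → allB p xs ≡ allB q xs
allB-cong p≗q [] = refl
allB-cong p≗q (x ∷ xs) = cong₂ _∧_ (p≗q x) (allB-cong p≗q xs)

allB-++ : {A : Set} (p : A → Bool) (xs ys : List A) → allB p (xs ++ ys) ≡ allB p xs ∧ allB p ys
allB-++ p [] ys = refl
allB-++ p (x ∷ xs) ys with p x
... | true = allB-++ p xs ys
... | false = refl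

allB-map : {A B : Set} (p : B → Bool) (f : A → B) (xs : List A) → allB p (map f xs) ≡ allB (p ∘ f) xs
allB-map p f [] = refl
allB-map p f (x ∷ xs) = cong (p (f x) ∧_) (allB-map p f xs)

allB-∈ : {A : Set} (p : A → Bool) {xs : List A} {x : A} → allB p xs ≡ true → x ∈ xs → p x ≡ true
allB-∈ p {y ∷ xs} holds (here refl) with p y
... | true = refl
allB-∈ p {y ∷ xs} holds (there x∈xs) with p y
... | true = allB-∈ p holds x∈xs

subsets-map : {A B : Set} (f : A → B) (xs : List A) → subsets (map f xs) ≡ map (map f) (subsets xs)
subsets-map f [] = refl
subsets-map f (x ∷ xs) = begin
    map (f x ∷_) (subsets (map f xs)) ++ subsets (map f xs)
  ≡⟨ cong (λ Ss → map (f x ∷_) Ss ++ Ss) (subsets-map f xs) ⟩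
    map (f x ∷_) (map (map f) (subsets xs)) ++ map (map f) (subsets xs)
  ≡⟨ cong (_++ map (map f) (subsets xs)) (trans (sym (map-∘ (subsets xs))) (map-∘ (subsets xs))) ⟩
    map (map f) (map (x ∷_) (subsets xs)) ++ map (map f) (subsets xs)
  ≡⟨ map-++ (map f) (map (x ∷_) (subsets xs)) (subsets xs) ⟨
    map (map f) (subsets (x ∷ xs))
  ∎
  where open ≡-Reasoning

concatMap-↭ : {A B : Set} {f g : A → List B} → (∀ x → f x ↭ g x) → (xs : List A) → concatMap f xs ↭ concatMap g xs
concatMap-↭ f↭g [] = ↭.refl
concatMap-↭ f↭g (x ∷ xs) = ++⁺ (f↭g x) (concatMap-↭ f↭g xs)

concatMap-++-↭ : {A B : Set} (f g : A → List B) (xs : List A) →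
  concatMap (λ x → f x ++ g x) xs ↭ concatMap f xs ++ concatMap g xs
concatMap-++-↭ f g [] = ↭.refl
concatMap-++-↭ f g (x ∷ xs) = begin
    (f x ++ g x) ++ concatMap (λ x → f x ++ g x) xs
  ↭⟨ ++⁺ˡ (f x ++ g x) (concatMap-++-↭ f g xs) ⟩
    (f x ++ g x) ++ (F ++ G)
  ≡⟨ trans (++-assoc (f x) (g x) (F ++ G)) (cong (f x ++_) (sym (++-assoc (g x) F G))) ⟩
    f x ++ ((g x ++ F) ++ G)
  ↭⟨ ++⁺ˡ (f x) (++⁺ʳ G (++-comm (g x) F)) ⟩
    f x ++ ((F ++ g x) ++ G)
  ≡⟨ trans (cong (f x ++_) (++-assoc F (g x) G)) (sym (++-assoc (f x) F (g x ++ G))) ⟩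
    (f x ++ F) ++ (g x ++ G)
  ∎
  where
  open PermutationReasoning
  F = concatMap f xs
  G = concatMap g xs

<ᵇ-suc : (m n : ℕ) → (m <ᵇ suc n) ≡ (m ≤ᵇ n)
<ᵇ-suc zero n = refl
<ᵇ-suc (suc m) n = refl

<-or-≡+ : (k n : ℕ) → n < k ⊎ ∃ λ m → n ≡ k + m
<-or-≡+ zero n = inj₂ (n , refl)
<-or-≡+ (suc k) zero = inj₁ (s≤s z≤n)
<-or-≡+ (suc k) (suc n) = Sum.map s≤s (λ (m , n≡k+m) → m , cong suc n≡k+m) (<-or-≡+ k n)


-- Exact covers

coverCount : List Tile → Cell → ℕ
coverCount S c = length (filter (λ t → T? (covers t c)) S)

coverCount-∷ : (t : Tile) (S : List Tile) (c : Cell) → coverCount (t ∷ S) c ≡ χ (covers t c) + coverCount S c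
coverCount-∷ t S c with covers t c
... | true = refl
... | false = refl

completes : List Cell → (Cell → ℕ) → List Tile → Bool
completes C d S = allB (λ c → d c + coverCount S c ≡ᵇ 1) C

exactCovers : List Tile → List Cell → (Cell → ℕ) → ℕ
exactCovers P C d = countᵇ (completes C d) (subsets P)

exactCovers-cong : (P : List Tile) (C : List Cell) {d d′ : Cell → ℕ} → (∀ c → d c ≡ d′ c) → exactCovers P C d ≡ exactCovers P C d′
exactCovers-cong P C d≗d′ = countᵇ-cong (λ S → allB-cong (λ c → cong (λ k → k + coverCount S c ≡ᵇ 1) (d≗d′ c)) C) (subsets P)

_+ₜ_ : (Cell → ℕ) → Tile → Cell → ℕ
(d +ₜ t) c = d c + χ (covers t c)

exactCovers-∷ : (t : Tile) (P : List Tile) (C : List Cell) (d : Cell → ℕ) →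
  exactCovers (t ∷ P) C d ≡ exactCovers P C (d +ₜ t) + exactCovers P C d
exactCovers-∷ t P C d = begin
    countᵇ (completes C d) (map (t ∷_) (subsets P) ++ subsets P)
  ≡⟨ countᵇ-++ (completes C d) (map (t ∷_) (subsets P)) (subsets P) ⟩
    countᵇ (completes C d) (map (t ∷_) (subsets P)) + exactCovers P C d
  ≡⟨ cong (_+ exactCovers P C d) (countᵇ-map (completes C d) (t ∷_) (subsets P)) ⟩
    countᵇ (completes C d ∘ (t ∷_)) (subsets P) + exactCovers P C d
  ≡⟨ cong (_+ exactCovers P C d) (countᵇ-cong (λ S → allB-cong (λ c → cong (_≡ᵇ 1) (add-t S c)) C) (subsets P)) ⟩
    exactCovers P C (d +ₜ t) + exactCovers P C d
  ∎
  where
  open ≡-Reasoning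
  add-t : (S : List Tile) (c : Cell) → d c + coverCount (t ∷ S) c ≡ (d +ₜ t) c + coverCount S c
  add-t S c = trans (cong (d c +_) (coverCount-∷ t S c)) (sym (+-assoc (d c) _ _))

exactCovers-↭ : {P P′ : List Tile} → P ↭ P′ → (C : List Cell) (d : Cell → ℕ) → exactCovers P C d ≡ exactCovers P′ C d
exactCovers-↭ ↭.refl C d = refl
exactCovers-↭ {t ∷ P} {.t ∷ P′} (↭.prep t p) C d =
  trans (exactCovers-∷ t P C d)
    (trans (cong₂ _+_ (exactCovers-↭ p C (d +ₜ t)) (exactCovers-↭ p C d)) (sym (exactCovers-∷ t P′ C d)))
exactCovers-↭ {t ∷ u ∷ P} {.u ∷ .t ∷ P′} (↭.swap .t .u p) C d = begin
    exactCovers (t ∷ u ∷ P) C d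
  ≡⟨ expand t u P ⟩
    (N P ((d +ₜ t) +ₜ u) + N P (d +ₜ t)) + (N P (d +ₜ u) + N P d)
  ≡⟨ interchange (N P ((d +ₜ t) +ₜ u)) _ _ _ ⟩
    (N P ((d +ₜ t) +ₜ u) + N P (d +ₜ u)) + (N P (d +ₜ t) + N P d)
  ≡⟨ cong₂ _+_ (cong₂ _+_ (trans (exactCovers-cong P C tiles-commute) (exactCovers-↭ p C ((d +ₜ u) +ₜ t)))
                          (exactCovers-↭ p C (d +ₜ u)))
               (cong₂ _+_ (exactCovers-↭ p C (d +ₜ t)) (exactCovers-↭ p C d)) ⟩
    (N P′ ((d +ₜ u) +ₜ t) + N P′ (d +ₜ u)) + (N P′ (d +ₜ t) + N P′ d)
  ≡⟨ expand u t P′ ⟨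
    exactCovers (u ∷ t ∷ P′) C d
  ∎
  where
  open ≡-Reasoning
  N : List Tile → (Cell → ℕ) → ℕ
  N Q = exactCovers Q C
  expand : (t u : Tile) (Q : List Tile) → N (t ∷ u ∷ Q) d ≡ (N Q ((d +ₜ t) +ₜ u) + N Q (d +ₜ t)) + (N Q (d +ₜ u) + N Q d)
  expand t u Q = trans (exactCovers-∷ t (u ∷ Q) C d) (cong₂ _+_ (exactCovers-∷ u Q C (d +ₜ t)) (exactCovers-∷ u Q C d))
  tiles-commute : ∀ c → ((d +ₜ t) +ₜ u) c ≡ ((d +ₜ u) +ₜ t) c
  tiles-commute c = trans (+-assoc (d c) _ _) (trans (cong (d c +_) (+-comm (χ (covers t c)) _)) (sym (+-assoc (d c) _ _)))
exactCovers-↭ (↭.trans p q) C d = trans (exactCovers-↭ p C d) (exactCovers-↭ q C d)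

exactCovers-++ : (B Q : List Tile) (C : List Cell) (d : Cell → ℕ) →
  exactCovers (B ++ Q) C d ≡ sum (map (λ S → exactCovers Q C (λ c → d c + coverCount S c)) (subsets B))
exactCovers-++ [] Q C d = trans (exactCovers-cong Q C (λ c → sym (+-identityʳ (d c)))) (sym (+-identityʳ _))
exactCovers-++ (t ∷ B) Q C d = begin
    exactCovers (t ∷ B ++ Q) C d
  ≡⟨ exactCovers-∷ t (B ++ Q) C d ⟩
    exactCovers (B ++ Q) C (d +ₜ t) + exactCovers (B ++ Q) C d
  ≡⟨ cong₂ _+_ (exactCovers-++ B Q C (d +ₜ t)) (exactCovers-++ B Q C d) ⟩
    sum (map (extend (d +ₜ t)) (subsets B)) + sum (map (extend d) (subsets B))
  ≡⟨ cong (_+ sum (map (extend d) (subsets B))) (with-t (subsets B)) ⟩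
    sum (map (extend d) (map (t ∷_) (subsets B))) + sum (map (extend d) (subsets B))
  ≡⟨ sum-++ (map (extend d) (map (t ∷_) (subsets B))) _ ⟨
    sum (map (extend d) (map (t ∷_) (subsets B)) ++ map (extend d) (subsets B))
  ≡⟨ cong sum (map-++ (extend d) (map (t ∷_) (subsets B)) (subsets B)) ⟨
    sum (map (extend d) (subsets (t ∷ B)))
  ∎
  where
  open ≡-Reasoning
  extend : (Cell → ℕ) → List Tile → ℕ
  extend d′ S = exactCovers Q C (λ c → d′ c + coverCount S c)
  with-t : (Ss : List (List Tile)) → sum (map (extend (d +ₜ t)) Ss) ≡ sum (map (extend d) (map (t ∷_) Ss))
  with-t [] = refl
  with-t (S ∷ Ss) = cong₂ _+_
    (exactCovers-cong Q C (λ c → trans (+-assoc (d c) _ _) (cong (d c +_) (sym (coverCount-∷ t S c))))) (with-t Ss)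

exactCovers-overfull : (P : List Tile) (C : List Cell) (d : Cell → ℕ) {c : Cell} → c ∈ C → 2 ≤ d c → exactCovers P C d ≡ 0
exactCovers-overfull P C d {c} c∈C 2≤dc = countᵇ-none (completes C d) (subsets P) incomplete
  where
  exceeds : (k l : ℕ) → 2 ≤ k → (k + l ≡ᵇ 1) ≡ false
  exceeds (suc (suc k)) l _ = refl
  exceeds (suc zero) l (s≤s ())
  incomplete : ∀ S → completes C d S ≡ false
  incomplete S with completes C d S in holds
  ... | false = refl
  ... | true with () ← trans (sym (allB-∈ _ holds c∈C)) (exceeds (d c) (coverCount S c) 2≤dc)

cells-mono : {m n n′ : ℕ} {c : Cell} → n ≤ n′ → c ∈ cells m n → c ∈ cells m n′
cells-mono {m} {n} {n′} n≤n′ c∈ = ∈-concatMap⁺ row′ {upTo m} (Any.map widen (∈-concatMap⁻ row {upTo m} c∈))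
  where
  row row′ : ℕ → List Cell
  row i = map (i ,_) (upTo n)
  row′ i = map (i ,_) (upTo n′)
  widen : ∀ {c i} → c ∈ row i → c ∈ row′ i
  widen {i = i} c∈row with j , j∈ , refl ← ∈-map⁻ (i ,_) c∈row = ∈-map⁺ (i ,_) (∈-upTo⁺ (<-≤-trans (∈-upTo⁻ j∈) n≤n′))

shiftCell : Cell → Cell
shiftCell (i , j) = (i , suc j)

shiftTile : Tile → Tile
shiftTile (x , y , w , h) = (x , suc y , w , h)

covers-shiftTile-column₀ : (t : Tile) (i : ℕ) → covers (shiftTile t) (i , 0) ≡ false
covers-shiftTile-column₀ (x , y , w , h) i = trans (cong ((x ≤ᵇ i) ∧_) (∧-zeroʳ (i <ᵇ x + w))) (∧-zeroʳ (x ≤ᵇ i))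

covers-shiftTile-shiftCell : (t : Tile) (c : Cell) → covers (shiftTile t) (shiftCell c) ≡ covers t c
covers-shiftTile-shiftCell (x , y , w , h) (i , j) rewrite <ᵇ-suc y j = refl

coverCount-shiftTile-column₀ : (S : List Tile) (i : ℕ) → coverCount (map shiftTile S) (i , 0) ≡ 0
coverCount-shiftTile-column₀ [] i = refl
coverCount-shiftTile-column₀ (t ∷ S) i =
  trans (coverCount-∷ (shiftTile t) (map shiftTile S) (i , 0))
        (cong₂ _+_ (cong χ (covers-shiftTile-column₀ t i)) (coverCount-shiftTile-column₀ S i))

coverCount-shiftTile-shiftCell : (S : List Tile) (c : Cell) → coverCount (map shiftTile S) (shiftCell c) ≡ coverCount S c
coverCount-shiftTile-shiftCell [] c = refl
coverCount-shiftTile-shiftCell (t ∷ S) c =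
  trans (coverCount-∷ (shiftTile t) (map shiftTile S) (shiftCell c))
    (trans (cong₂ _+_ (cong χ (covers-shiftTile-shiftCell t c)) (coverCount-shiftTile-shiftCell S c)) (sym (coverCount-∷ t S c)))

allB-cells-suc : (p : Cell → Bool) (m n : ℕ) →
  allB p (cells m (suc n)) ≡ allB (λ i → p (i , 0)) (upTo m) ∧ allB (p ∘ shiftCell) (cells m n)
allB-cells-suc p m n = go (upTo m)
  where
  row : ℕ → ℕ → List Cell
  row k i = map (i ,_) (upTo k)
  regroup : (a b c e : Bool) → a ∧ (b ∧ (c ∧ e)) ≡ (a ∧ c) ∧ (b ∧ e)
  regroup true true c e = refl
  regroup true false c e = sym (∧-zeroʳ c)
  regroup false b c e = refl
  tail-row : (i : ℕ) → allB p (map (i ,_) (applyUpTo suc n)) ≡ allB (p ∘ shiftCell) (row n i)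
  tail-row i = begin
      allB p (map (i ,_) (applyUpTo suc n))
    ≡⟨ cong (allB p ∘ map (i ,_)) (map-upTo suc n) ⟨
      allB p (map (i ,_) (map suc (upTo n)))
    ≡⟨ trans (allB-map p (i ,_) (map suc (upTo n))) (allB-map (λ j → p (i , j)) suc (upTo n)) ⟩
      allB (λ j → p (i , suc j)) (upTo n)
    ≡⟨ allB-map (p ∘ shiftCell) (i ,_) (upTo n) ⟨
      allB (p ∘ shiftCell) (row n i)
    ∎
    where open ≡-Reasoning
  first rest : List ℕ → Bool
  first is = allB (λ i → p (i , 0)) is
  rest is = allB (p ∘ shiftCell) (concatMap (row n) is)
  go : (is : List ℕ) → allB p (concatMap (row (suc n)) is) ≡ first is ∧ rest is
  go [] = refl
  go (i ∷ is) = begin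
      p (i , 0) ∧ allB p (map (i ,_) (applyUpTo suc n) ++ concatMap (row (suc n)) is)
    ≡⟨ cong (p (i , 0) ∧_) (allB-++ p (map (i ,_) (applyUpTo suc n)) (concatMap (row (suc n)) is)) ⟩
      p (i , 0) ∧ (allB p (map (i ,_) (applyUpTo suc n)) ∧ allB p (concatMap (row (suc n)) is))
    ≡⟨ cong (p (i , 0) ∧_) (cong₂ _∧_ (tail-row i) (go is)) ⟩
      p (i , 0) ∧ (allB (p ∘ shiftCell) (row n i) ∧ (first is ∧ rest is))
    ≡⟨ regroup (p (i , 0)) (allB (p ∘ shiftCell) (row n i)) (first is) (rest is) ⟩
      first (i ∷ is) ∧ (allB (p ∘ shiftCell) (row n i) ∧ rest is)
    ≡⟨ cong (first (i ∷ is) ∧_) (allB-++ (p ∘ shiftCell) (row n i) (concatMap (row n) is)) ⟨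
      first (i ∷ is) ∧ rest (i ∷ is)
    ∎
    where open ≡-Reasoning

exactCovers-shift : (P : List Tile) (m n : ℕ) (d : Cell → ℕ) →
  exactCovers (map shiftTile P) (cells m (suc n)) d
    ≡ (if allB (λ i → d (i , 0) ≡ᵇ 1) (upTo m) then exactCovers P (cells m n) (d ∘ shiftCell) else 0)
exactCovers-shift P m n d = begin
    countᵇ (completes (cells m (suc n)) d) (subsets (map shiftTile P))
  ≡⟨ cong (countᵇ (completes (cells m (suc n)) d)) (subsets-map shiftTile P) ⟩
    countᵇ (completes (cells m (suc n)) d) (map (map shiftTile) (subsets P))
  ≡⟨ countᵇ-map _ (map shiftTile) (subsets P) ⟩
    countᵇ (completes (cells m (suc n)) d ∘ map shiftTile) (subsets P)
  ≡⟨ countᵇ-cong split (subsets P) ⟩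
    countᵇ (λ S → firstColumn ∧ completes (cells m n) (d ∘ shiftCell) S) (subsets P)
  ≡⟨ countᵇ-∧ˡ firstColumn _ (subsets P) ⟩
    (if firstColumn then exactCovers P (cells m n) (d ∘ shiftCell) else 0)
  ∎
  where
  open ≡-Reasoning
  firstColumn = allB (λ i → d (i , 0) ≡ᵇ 1) (upTo m)
  split : (S : List Tile) → completes (cells m (suc n)) d (map shiftTile S) ≡ firstColumn ∧ completes (cells m n) (d ∘ shiftCell) S
  split S = trans (allB-cells-suc _ m n) (cong₂ _∧_
    (allB-cong (λ i → cong (_≡ᵇ 1) (trans (cong (d (i , 0) +_) (coverCount-shiftTile-column₀ S i)) (+-identityʳ _))) (upTo m))
    (allB-cong (λ c → cong (λ k → d (shiftCell c) + k ≡ᵇ 1) (coverCount-shiftTile-shiftCell S c)) (cells m n)))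

fitting : ℕ → ℕ → ℕ × ℕ → ℕ → ℕ → List Tile
fitting m n (w , h) x y = if (x + w ≤ᵇ m) ∧ (y + h ≤ᵇ n) then (x , y , w , h) ∷ [] else []

leftmostPlacements : ℕ → ℕ → ℕ → ℕ → List Tile
leftmostPlacements m n a b = concatMap (λ o → concatMap (λ x → fitting m n o x 0) (upTo m)) (orientations a b)

fitting-suc : (m n : ℕ) (o : ℕ × ℕ) (x y : ℕ) → fitting m (suc n) o x (suc y) ≡ map shiftTile (fitting m n o x y)
fitting-suc m n (w , h) x y rewrite <ᵇ-suc (y + h) n with (x + w ≤ᵇ m) ∧ (y + h ≤ᵇ n)
... | true = refl
... | false = refl

columns-suc : (m n : ℕ) (o : ℕ × ℕ) (x : ℕ) →
  concatMap (fitting m (suc n) o x) (upTo (suc n)) ≡ fitting m (suc n) o x 0 ++ map shiftTile (concatMap (fitting m n o x) (upTo n))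
columns-suc m n o x = cong (fitting m (suc n) o x 0 ++_) (begin
    concatMap (fitting m (suc n) o x) (applyUpTo suc n)
  ≡⟨ cong (concatMap (fitting m (suc n) o x)) (map-upTo suc n) ⟨
    concatMap (fitting m (suc n) o x) (map suc (upTo n))
  ≡⟨ concatMap-map (fitting m (suc n) o x) suc (upTo n) ⟩
    concatMap (fitting m (suc n) o x ∘ suc) (upTo n)
  ≡⟨ concatMap-cong (fitting-suc m n o x) (upTo n) ⟩
    concatMap (map shiftTile ∘ fitting m n o x) (upTo n)
  ≡⟨ map-concatMap shiftTile (fitting m n o x) (upTo n) ⟨
    map shiftTile (concatMap (fitting m n o x) (upTo n))
  ∎)
  where open ≡-Reasoning

placements-suc : (m n a b : ℕ) →
  placements m (suc n) a b ↭ leftmostPlacements m (suc n) a b ++ map shiftTile (placements m n a b)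
placements-suc m n a b = begin
    concatMap (λ o → concatMap (λ x → concatMap (fitting m (suc n) o x) (upTo (suc n))) (upTo m)) (orientations a b)
  ≡⟨ concatMap-cong (λ o → concatMap-cong (columns-suc m n o) (upTo m)) (orientations a b) ⟩
    concatMap (λ o → concatMap (λ x → fitting m (suc n) o x 0 ++ map shiftTile (column o x)) (upTo m)) (orientations a b)
  ↭⟨ concatMap-↭ (λ o → concatMap-++-↭ (λ x → fitting m (suc n) o x 0) (map shiftTile ∘ column o) (upTo m)) (orientations a b) ⟩
    concatMap (λ o → first o ++ concatMap (map shiftTile ∘ column o) (upTo m)) (orientations a b)
  ↭⟨ concatMap-++-↭ first (λ o → concatMap (map shiftTile ∘ column o) (upTo m)) (orientations a b) ⟩
    leftmostPlacements m (suc n) a b ++ concatMap (λ o → concatMap (map shiftTile ∘ column o) (upTo m)) (orientations a b)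
  ≡⟨ cong (leftmostPlacements m (suc n) a b ++_) (shifted-out (orientations a b)) ⟩
    leftmostPlacements m (suc n) a b ++ map shiftTile (placements m n a b)
  ∎
  where
  open PermutationReasoning
  column : ℕ × ℕ → ℕ → List Tile
  column o x = concatMap (fitting m n o x) (upTo n)
  first : ℕ × ℕ → List Tile
  first o = concatMap (λ x → fitting m (suc n) o x 0) (upTo m)
  shifted-out : ∀ os → concatMap (λ o → concatMap (map shiftTile ∘ column o) (upTo m)) os
                      ≡ map shiftTile (concatMap (λ o → concatMap (column o) (upTo m)) os)
  shifted-out os = trans (concatMap-cong (λ o → sym (map-concatMap shiftTile (column o) (upTo m))) os)
                         (sym (map-concatMap shiftTile (λ o → concatMap (column o) (upTo m)) os))

exactCovers-suc : (m n a b : ℕ) (d : Cell → ℕ) →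
  exactCovers (placements m (suc n) a b) (cells m (suc n)) d ≡
  sum (map (λ S → if allB (λ i → d (i , 0) + coverCount S (i , 0) ≡ᵇ 1) (upTo m)
                  then exactCovers (placements m n a b) (cells m n) (λ c → d (shiftCell c) + coverCount S (shiftCell c))
                  else 0)
           (subsets (leftmostPlacements m (suc n) a b)))
exactCovers-suc m n a b d = begin
    exactCovers (placements m (suc n) a b) (cells m (suc n)) d
  ≡⟨ exactCovers-↭ (placements-suc m n a b) (cells m (suc n)) d ⟩
    exactCovers (leftmostPlacements m (suc n) a b ++ map shiftTile (placements m n a b)) (cells m (suc n)) d
  ≡⟨ exactCovers-++ (leftmostPlacements m (suc n) a b) (map shiftTile (placements m n a b)) (cells m (suc n)) d ⟩
    sum (map (λ S → exactCovers (map shiftTile (placements m n a b)) (cells m (suc n)) (λ c → d c + coverCount S c))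
             (subsets (leftmostPlacements m (suc n) a b)))
  ≡⟨ cong sum (map-cong (λ S → exactCovers-shift (placements m n a b) m n (λ c → d c + coverCount S c))
                        (subsets (leftmostPlacements m (suc n) a b))) ⟩
    sum (map (λ S → if allB (λ i → d (i , 0) + coverCount S (i , 0) ≡ᵇ 1) (upTo m)
                    then exactCovers (placements m n a b) (cells m n) (λ c → d (shiftCell c) + coverCount S (shiftCell c))
                    else 0)
             (subsets (leftmostPlacements m (suc n) a b)))
  ∎
  where open ≡-Reasoning


-- Profiles

-- Entry (i , j) is the number of tiles already covering cell (i , j); missing entries are 0.
Profile : Set
Profile = List (List ℕ)

nthOr : {A : Set} → A → List A → ℕ → A
nthOr d [] i = d
nthOr d (x ∷ xs) zero = x
nthOr d (x ∷ xs) (suc i) = nthOr d xs i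

occupancy : Profile → Cell → ℕ
occupancy U (i , j) = nthOr 0 (nthOr [] U i) j

zipPad : {A : Set} → (A → A → A) → List A → List A → List A
zipPad f [] ys = ys
zipPad f (x ∷ xs) [] = x ∷ xs
zipPad f (x ∷ xs) (y ∷ ys) = f x y ∷ zipPad f xs ys

nthOr-zipPad : {A : Set} (f : A → A → A) (d : A) → (∀ x → f x d ≡ x) → (∀ y → f d y ≡ y) →
  (xs ys : List A) (i : ℕ) → nthOr d (zipPad f xs ys) i ≡ f (nthOr d xs i) (nthOr d ys i)
nthOr-zipPad f d idʳ idˡ [] ys i = sym (idˡ (nthOr d ys i))
nthOr-zipPad f d idʳ idˡ (x ∷ xs) [] i = sym (idʳ (nthOr d (x ∷ xs) i))
nthOr-zipPad f d idʳ idˡ (x ∷ xs) (y ∷ ys) zero = refl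
nthOr-zipPad f d idʳ idˡ (x ∷ xs) (y ∷ ys) (suc i) = nthOr-zipPad f d idʳ idˡ xs ys i

_⊞_ : Profile → Profile → Profile
_⊞_ = zipPad (zipPad _+_)

occupancy-⊞ : (U V : Profile) (c : Cell) → occupancy (U ⊞ V) c ≡ occupancy U c + occupancy V c
occupancy-⊞ U V (i , j) = trans
  (cong (λ r → nthOr 0 r j) (nthOr-zipPad (zipPad _+_) [] zipPad-[] (λ _ → refl) U V i))
  (nthOr-zipPad _+_ 0 +-identityʳ (λ _ → refl) (nthOr [] U i) (nthOr [] V i) j)
  where
  zipPad-[] : (r : List ℕ) → zipPad _+_ r [] ≡ r
  zipPad-[] [] = refl
  zipPad-[] (_ ∷ _) = refl

nthOr-block : {A : Set} (d v : A) (x w i : ℕ) →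
  nthOr d (replicate x d ++ replicate w v) i ≡ (if (x ≤ᵇ i) ∧ (i <ᵇ x + w) then v else d)
nthOr-block d v zero zero i = refl
nthOr-block d v zero (suc w) zero = refl
nthOr-block d v zero (suc w) (suc i) = nthOr-block d v zero w i
nthOr-block d v (suc x) w zero = refl
nthOr-block d v (suc x) w (suc i) rewrite <ᵇ-suc x i = nthOr-block d v x w i

tileProfile : Tile → Profile
tileProfile (x , y , w , h) = replicate x [] ++ replicate w (replicate y 0 ++ replicate h 1)

occupancy-tileProfile : (t : Tile) (c : Cell) → occupancy (tileProfile t) c ≡ χ (covers t c)
occupancy-tileProfile (x , y , w , h) (i , j) = begin
    nthOr 0 (nthOr [] (replicate x [] ++ replicate w row) i) j
  ≡⟨ cong (λ r → nthOr 0 r j) (nthOr-block [] row x w i) ⟩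
    nthOr 0 (if inRows then row else []) j
  ≡⟨ restrict inRows ⟩
    χ (inRows ∧ inColumns)
  ≡⟨ cong χ (∧-assoc (x ≤ᵇ i) (i <ᵇ x + w) inColumns) ⟩
    χ (covers (x , y , w , h) (i , j))
  ∎
  where
  open ≡-Reasoning
  row = replicate y 0 ++ replicate h 1
  inRows = (x ≤ᵇ i) ∧ (i <ᵇ x + w)
  inColumns = (y ≤ᵇ j) ∧ (j <ᵇ y + h)
  χ-if : (b : Bool) → (if b then 1 else 0) ≡ χ b
  χ-if true = refl
  χ-if false = refl
  restrict : (b : Bool) → nthOr 0 (if b then row else []) j ≡ χ (b ∧ inColumns)
  restrict true = trans (nthOr-block 0 1 y h j) (χ-if inColumns)
  restrict false = refl

tilesProfile : List Tile → Profile
tilesProfile = foldr (λ t U → tileProfile t ⊞ U) []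

occupancy-tilesProfile : (S : List Tile) (c : Cell) → occupancy (tilesProfile S) c ≡ coverCount S c
occupancy-tilesProfile [] c = refl
occupancy-tilesProfile (t ∷ S) c = begin
    occupancy (tileProfile t ⊞ tilesProfile S) c
  ≡⟨ occupancy-⊞ (tileProfile t) (tilesProfile S) c ⟩
    occupancy (tileProfile t) c + occupancy (tilesProfile S) c
  ≡⟨ cong₂ _+_ (occupancy-tileProfile t c) (occupancy-tilesProfile S c) ⟩
    χ (covers t c) + coverCount S c
  ≡⟨ coverCount-∷ t S c ⟨
    coverCount (t ∷ S) c
  ∎
  where open ≡-Reasoning

addTiles : List Tile → Profile → Profile
addTiles S U = tilesProfile S ⊞ U

shift : Profile → Profile
shift = map (drop 1)

occupancy-shift : (U : Profile) (c : Cell) → occupancy (shift U) c ≡ occupancy U (shiftCell c)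
occupancy-shift [] (i , j) = refl
occupancy-shift (r ∷ U) (zero , j) = drop-row r
  where
  drop-row : (r : List ℕ) → nthOr 0 (drop 1 r) j ≡ nthOr 0 r (suc j)
  drop-row [] = refl
  drop-row (_ ∷ _) = refl
occupancy-shift (r ∷ U) (suc i , j) = occupancy-shift U (i , j)

consUnless : {A : Set} → (A → Bool) → A → List A → List A
consUnless p x [] = if p x then [] else x ∷ []
consUnless p x (y ∷ ys) = x ∷ y ∷ ys

trimEnd : {A : Set} → (A → Bool) → List A → List A
trimEnd p = foldr (consUnless p) []

nthOr-trimEnd : {A : Set} (p : A → Bool) (d : A) → (∀ x → p x ≡ true → x ≡ d) →
  (xs : List A) (i : ℕ) → nthOr d (trimEnd p xs) i ≡ nthOr d xs i
nthOr-trimEnd p d default [] i = refl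
nthOr-trimEnd p d default (x ∷ xs) i = trans (consUnless-ok (trimEnd p xs) i) (tail-ok i)
  where
  consUnless-ok : (ys : List _) (i : ℕ) → nthOr d (consUnless p x ys) i ≡ nthOr d (x ∷ ys) i
  consUnless-ok (_ ∷ _) i = refl
  consUnless-ok [] i with p x in px
  ... | false = refl
  ... | true with i
  ...   | zero = sym (default x px)
  ...   | suc _ = refl
  tail-ok : (i : ℕ) → nthOr d (x ∷ trimEnd p xs) i ≡ nthOr d (x ∷ xs) i
  tail-ok zero = refl
  tail-ok (suc i) = nthOr-trimEnd p d default xs i

-- Profiles are compared syntactically, so trailing empty rows are removed.
canonical : Profile → Profile
canonical = trimEnd null

occupancy-canonical : (U : Profile) (c : Cell) → occupancy (canonical U) c ≡ occupancy U c
occupancy-canonical U (i , j) = cong (λ r → nthOr 0 r j) (nthOr-trimEnd null [] empty U i)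
  where
  empty : (r : List ℕ) → null r ≡ true → r ≡ []
  empty [] _ = refl


_≟ᵖ_ : DecidableEquality Profile
_≟ᵖ_ = ≡-dec (≡-dec ℕ._≟_)

lexᵇ : {A : Set} → (A → A → Bool) → (A → A → Bool) → List A → List A → Bool
lexᵇ eq lt [] [] = false
lexᵇ eq lt [] (_ ∷ _) = true
lexᵇ eq lt (_ ∷ _) [] = false
lexᵇ eq lt (x ∷ xs) (y ∷ ys) = lt x y ∨ (eq x y ∧ lexᵇ eq lt xs ys)

_<ᵖ_ : Profile → Profile → Bool
_<ᵖ_ = lexᵇ (λ r s → does (≡-dec ℕ._≟_ r s)) (lexᵇ _≡ᵇ_ _<ᵇ_)

LinComb : Set
LinComb = List (ℕ × Profile)

insert : ℕ × Profile → LinComb → LinComb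
insert (k , U) [] = (k , U) ∷ []
insert (k , U) ((l , V) ∷ F) with U ≟ᵖ V
... | yes _ = (k + l , V) ∷ F
... | no _ = if U <ᵖ V then (k , U) ∷ (l , V) ∷ F else (l , V) ∷ insert (k , U) F

normalize : LinComb → LinComb
normalize = foldr insert []

_·_ : ℕ → LinComb → LinComb
k · F = map (λ (l , U) → (k * l , U)) F

infixr 7 _·_

-- Opaque, so that the type checker never tries to evaluate a number of completions.
opaque
  completions : ℕ → Profile → ℕ
  completions n U = exactCovers (placements 6 n 1 4) (cells 6 n) (occupancy U)

⟦_⟧ : LinComb → ℕ → ℕ
⟦ [] ⟧ n = 0
⟦ (k , U) ∷ F ⟧ n = k * completions n U + ⟦ F ⟧ n

⟦⟧-++ : (F G : LinComb) (n : ℕ) → ⟦ F ++ G ⟧ n ≡ ⟦ F ⟧ n + ⟦ G ⟧ n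
⟦⟧-++ [] G n = refl
⟦⟧-++ ((k , U) ∷ F) G n = trans (cong (k * completions n U +_) (⟦⟧-++ F G n)) (sym (+-assoc (k * completions n U) _ _))

⟦⟧-· : (k : ℕ) (F : LinComb) (n : ℕ) → ⟦ k · F ⟧ n ≡ k * ⟦ F ⟧ n
⟦⟧-· k [] n = sym (*-zeroʳ k)
⟦⟧-· k ((l , U) ∷ F) n =
  trans (cong₂ _+_ (*-assoc k l (completions n U)) (⟦⟧-· k F n)) (sym (*-distribˡ-+ k _ _))

⟦⟧-concatMap : {A : Set} (g : A → LinComb) (xs : List A) (n : ℕ) → ⟦ concatMap g xs ⟧ n ≡ sum (map (λ x → ⟦ g x ⟧ n) xs)
⟦⟧-concatMap g [] n = refl
⟦⟧-concatMap g (x ∷ xs) n = trans (⟦⟧-++ (g x) (concatMap g xs) n) (cong (⟦ g x ⟧ n +_) (⟦⟧-concatMap g xs n))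

⟦⟧-insert : (k : ℕ) (U : Profile) (F : LinComb) (n : ℕ) → ⟦ insert (k , U) F ⟧ n ≡ k * completions n U + ⟦ F ⟧ n
⟦⟧-insert k U [] n = refl
⟦⟧-insert k U ((l , V) ∷ F) n with U ≟ᵖ V
... | yes refl = trans (cong (_+ ⟦ F ⟧ n) (*-distribʳ-+ (completions n U) k l)) (+-assoc (k * completions n U) _ _)
... | no _ with U <ᵖ V
...   | true = refl
...   | false = trans (cong (l * completions n V +_) (⟦⟧-insert k U F n)) (x∙yz≈y∙xz (l * completions n V) (k * completions n U) _)

⟦⟧-normalize : (F : LinComb) (n : ℕ) → ⟦ normalize F ⟧ n ≡ ⟦ F ⟧ n
⟦⟧-normalize [] n = refl
⟦⟧-normalize ((k , U) ∷ F) n = trans (⟦⟧-insert k U (normalize F) n) (cong (k * completions n U +_) (⟦⟧-normalize F n))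


-- The transfer step

firstColumnFilled : Profile → Bool
firstColumnFilled U = allB (λ i → occupancy U (i , 0) ≡ᵇ 1) (upTo 6)

-- Overfull profiles have no completions; discarding them keeps the reachable profiles finitely many.
overfull : Profile → Bool
overfull U = any (λ c → 2 ≤ᵇ occupancy U c) (cells 6 3)

advance : Profile → Profile
advance U = canonical (shift U)

successor : Profile → List Tile → LinComb
successor U S =
  if firstColumnFilled (addTiles S U) ∧ not (overfull (advance (addTiles S U)))
  then (1 , advance (addTiles S U)) ∷ [] else []

transfer : Profile → LinComb
transfer U = normalize (concatMap (successor U) (subsets (leftmostPlacements 6 4 1 4)))

completionsAfter : ℕ → Profile → List Tile → ℕ
completionsAfter n U S = if firstColumnFilled (addTiles S U) then completions n (advance (addTiles S U)) else 0

opaque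
  unfolding completions

  completions-overfull : (n : ℕ) (U : Profile) → overfull U ≡ true → completions (3 + n) U ≡ 0
  completions-overfull n U full
    with c , c∈ , 2≤c ← find (any⁻ (λ c → 2 ≤ᵇ occupancy U c) (cells 6 3) (Equivalence.from T-≡ full))
    = exactCovers-overfull (placements 6 (3 + n) 1 4) (cells 6 (3 + n)) (occupancy U)
        (cells-mono {6} (m≤m+n 3 n) c∈) (≤ᵇ⇒≤ 2 (occupancy U c) 2≤c)

  completions-suc : (n : ℕ) (U : Profile) →
    completions (4 + n) U ≡ sum (map (completionsAfter (3 + n) U) (subsets (leftmostPlacements 6 (4 + n) 1 4)))
  completions-suc n U =
    trans (exactCovers-suc 6 (3 + n) 1 4 (occupancy U))
          (cong sum (map-cong (λ S → cong₂ (λ b k → if b then k else 0)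
                                           (allB-cong (λ i → cong (_≡ᵇ 1) (added S (i , 0))) (upTo 6))
                                           (exactCovers-cong (placements 6 (3 + n) 1 4) (cells 6 (3 + n)) (advanced S)))
                              (subsets (leftmostPlacements 6 (4 + n) 1 4))))
    where
    added : (S : List Tile) (c : Cell) → occupancy U c + coverCount S c ≡ occupancy (addTiles S U) c
    added S c = sym (trans (occupancy-⊞ (tilesProfile S) U c)
                           (trans (cong (_+ occupancy U c) (occupancy-tilesProfile S c)) (+-comm (coverCount S c) _)))
    advanced : (S : List Tile) (c : Cell) → occupancy U (shiftCell c) + coverCount S (shiftCell c) ≡ occupancy (advance (addTiles S U)) c
    advanced S c = trans (added S (shiftCell c))
                         (sym (trans (occupancy-canonical (shift (addTiles S U)) c) (occupancy-shift (addTiles S U) c)))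

-- Holds by evaluation, but leaving it implicit makes the type checker normalise 512 subsets.
leftmostPlacements-wide : (n : ℕ) → leftmostPlacements 6 (4 + n) 1 4 ≡ leftmostPlacements 6 4 1 4
leftmostPlacements-wide n = refl

successor-sound : (n : ℕ) (U : Profile) (S : List Tile) → ⟦ successor U S ⟧ (3 + n) ≡ completionsAfter (3 + n) U S
successor-sound n U S with firstColumnFilled (addTiles S U)
... | false = refl
... | true with overfull (advance (addTiles S U)) in full
...   | false = trans (+-identityʳ _) (*-identityˡ _)
...   | true = sym (completions-overfull n (advance (addTiles S U)) full)

transfer-sound : (n : ℕ) (U : Profile) → completions (4 + n) U ≡ ⟦ transfer U ⟧ (3 + n)
transfer-sound n U = begin
    completions (4 + n) U
  ≡⟨ completions-suc n U ⟩
    sum (map (completionsAfter (3 + n) U) (subsets (leftmostPlacements 6 (4 + n) 1 4)))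
  ≡⟨ cong (sum ∘ map (completionsAfter (3 + n) U) ∘ subsets) (leftmostPlacements-wide n) ⟩
    sum (map (completionsAfter (3 + n) U) Ss)
  ≡⟨ cong sum (map-cong (λ S → sym (successor-sound n U S)) Ss) ⟩
    sum (map (λ S → ⟦ successor U S ⟧ (3 + n)) Ss)
  ≡⟨ ⟦⟧-concatMap (successor U) Ss (3 + n) ⟨
    ⟦ concatMap (successor U) Ss ⟧ (3 + n)
  ≡⟨ ⟦⟧-normalize (concatMap (successor U) Ss) (3 + n) ⟨
    ⟦ transfer U ⟧ (3 + n)
  ∎
  where
  open ≡-Reasoning
  Ss = subsets (leftmostPlacements 6 4 1 4)

-- The profile whose row i has its first kᵢ cells covered; all reachable profiles have this shape.
⟨_∣_∣_∣_∣_∣_⟩ : ℕ → ℕ → ℕ → ℕ → ℕ → ℕ → Profile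
⟨ a ∣ b ∣ c ∣ d ∣ e ∣ f ⟩ = canonical (map (λ k → replicate k 1) (a ∷ b ∷ c ∷ d ∷ e ∷ f ∷ []))

_↦_ : Profile → List Profile → Profile × LinComb
U ↦ Vs = U , map (1 ,_) Vs

infix 4 _↦_

-- The transfer of every profile reachable from the empty one, checked by evaluation in
-- transitions-correct; step looks transfers up here instead of recomputing them.
transitions : List (Profile × LinComb)
transitions =
    (⟨ 0 ∣ 0 ∣ 0 ∣ 0 ∣ 0 ∣ 0 ⟩ ↦ ⟨ 0 ∣ 0 ∣ 0 ∣ 0 ∣ 3 ∣ 3 ⟩ ∷ ⟨ 3 ∣ 0 ∣ 0 ∣ 0 ∣ 0 ∣ 3 ⟩ ∷ ⟨ 3 ∣ 3 ∣ 0 ∣ 0 ∣ 0 ∣ 0 ⟩ ∷ ⟨ 3 ∣ 3 ∣ 3 ∣ 3 ∣ 3 ∣ 3 ⟩ ∷ [])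
  ∷ (⟨ 0 ∣ 0 ∣ 0 ∣ 0 ∣ 3 ∣ 3 ⟩ ↦ ⟨ 0 ∣ 0 ∣ 0 ∣ 0 ∣ 2 ∣ 2 ⟩ ∷ ⟨ 3 ∣ 3 ∣ 3 ∣ 3 ∣ 2 ∣ 2 ⟩ ∷ [])
  ∷ (⟨ 3 ∣ 0 ∣ 0 ∣ 0 ∣ 0 ∣ 3 ⟩ ↦ ⟨ 2 ∣ 0 ∣ 0 ∣ 0 ∣ 0 ∣ 2 ⟩ ∷ ⟨ 2 ∣ 3 ∣ 3 ∣ 3 ∣ 3 ∣ 2 ⟩ ∷ [])
  ∷ (⟨ 3 ∣ 3 ∣ 0 ∣ 0 ∣ 0 ∣ 0 ⟩ ↦ ⟨ 2 ∣ 2 ∣ 0 ∣ 0 ∣ 0 ∣ 0 ⟩ ∷ ⟨ 2 ∣ 2 ∣ 3 ∣ 3 ∣ 3 ∣ 3 ⟩ ∷ [])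
  ∷ (⟨ 3 ∣ 3 ∣ 3 ∣ 3 ∣ 3 ∣ 3 ⟩ ↦ ⟨ 2 ∣ 2 ∣ 2 ∣ 2 ∣ 2 ∣ 2 ⟩ ∷ [])
  ∷ (⟨ 0 ∣ 0 ∣ 0 ∣ 0 ∣ 2 ∣ 2 ⟩ ↦ ⟨ 0 ∣ 0 ∣ 0 ∣ 0 ∣ 1 ∣ 1 ⟩ ∷ ⟨ 3 ∣ 3 ∣ 3 ∣ 3 ∣ 1 ∣ 1 ⟩ ∷ [])
  ∷ (⟨ 3 ∣ 3 ∣ 3 ∣ 3 ∣ 2 ∣ 2 ⟩ ↦ ⟨ 2 ∣ 2 ∣ 2 ∣ 2 ∣ 1 ∣ 1 ⟩ ∷ [])
  ∷ (⟨ 2 ∣ 0 ∣ 0 ∣ 0 ∣ 0 ∣ 2 ⟩ ↦ ⟨ 1 ∣ 0 ∣ 0 ∣ 0 ∣ 0 ∣ 1 ⟩ ∷ ⟨ 1 ∣ 3 ∣ 3 ∣ 3 ∣ 3 ∣ 1 ⟩ ∷ [])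
  ∷ (⟨ 2 ∣ 3 ∣ 3 ∣ 3 ∣ 3 ∣ 2 ⟩ ↦ ⟨ 1 ∣ 2 ∣ 2 ∣ 2 ∣ 2 ∣ 1 ⟩ ∷ [])
  ∷ (⟨ 2 ∣ 2 ∣ 0 ∣ 0 ∣ 0 ∣ 0 ⟩ ↦ ⟨ 1 ∣ 1 ∣ 0 ∣ 0 ∣ 0 ∣ 0 ⟩ ∷ ⟨ 1 ∣ 1 ∣ 3 ∣ 3 ∣ 3 ∣ 3 ⟩ ∷ [])
  ∷ (⟨ 2 ∣ 2 ∣ 3 ∣ 3 ∣ 3 ∣ 3 ⟩ ↦ ⟨ 1 ∣ 1 ∣ 2 ∣ 2 ∣ 2 ∣ 2 ⟩ ∷ [])
  ∷ (⟨ 2 ∣ 2 ∣ 2 ∣ 2 ∣ 2 ∣ 2 ⟩ ↦ ⟨ 1 ∣ 1 ∣ 1 ∣ 1 ∣ 1 ∣ 1 ⟩ ∷ [])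
  ∷ (⟨ 0 ∣ 0 ∣ 0 ∣ 0 ∣ 1 ∣ 1 ⟩ ↦ ⟨ 0 ∣ 0 ∣ 0 ∣ 0 ∣ 0 ∣ 0 ⟩ ∷ ⟨ 3 ∣ 3 ∣ 3 ∣ 3 ∣ 0 ∣ 0 ⟩ ∷ [])
  ∷ (⟨ 3 ∣ 3 ∣ 3 ∣ 3 ∣ 1 ∣ 1 ⟩ ↦ ⟨ 2 ∣ 2 ∣ 2 ∣ 2 ∣ 0 ∣ 0 ⟩ ∷ [])
  ∷ (⟨ 2 ∣ 2 ∣ 2 ∣ 2 ∣ 1 ∣ 1 ⟩ ↦ ⟨ 1 ∣ 1 ∣ 1 ∣ 1 ∣ 0 ∣ 0 ⟩ ∷ [])
  ∷ (⟨ 1 ∣ 0 ∣ 0 ∣ 0 ∣ 0 ∣ 1 ⟩ ↦ ⟨ 0 ∣ 0 ∣ 0 ∣ 0 ∣ 0 ∣ 0 ⟩ ∷ ⟨ 0 ∣ 3 ∣ 3 ∣ 3 ∣ 3 ∣ 0 ⟩ ∷ [])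
  ∷ (⟨ 1 ∣ 3 ∣ 3 ∣ 3 ∣ 3 ∣ 1 ⟩ ↦ ⟨ 0 ∣ 2 ∣ 2 ∣ 2 ∣ 2 ∣ 0 ⟩ ∷ [])
  ∷ (⟨ 1 ∣ 2 ∣ 2 ∣ 2 ∣ 2 ∣ 1 ⟩ ↦ ⟨ 0 ∣ 1 ∣ 1 ∣ 1 ∣ 1 ∣ 0 ⟩ ∷ [])
  ∷ (⟨ 1 ∣ 1 ∣ 0 ∣ 0 ∣ 0 ∣ 0 ⟩ ↦ ⟨ 0 ∣ 0 ∣ 0 ∣ 0 ∣ 0 ∣ 0 ⟩ ∷ ⟨ 0 ∣ 0 ∣ 3 ∣ 3 ∣ 3 ∣ 3 ⟩ ∷ [])
  ∷ (⟨ 1 ∣ 1 ∣ 3 ∣ 3 ∣ 3 ∣ 3 ⟩ ↦ ⟨ 0 ∣ 0 ∣ 2 ∣ 2 ∣ 2 ∣ 2 ⟩ ∷ [])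
  ∷ (⟨ 1 ∣ 1 ∣ 2 ∣ 2 ∣ 2 ∣ 2 ⟩ ↦ ⟨ 0 ∣ 0 ∣ 1 ∣ 1 ∣ 1 ∣ 1 ⟩ ∷ [])
  ∷ (⟨ 1 ∣ 1 ∣ 1 ∣ 1 ∣ 1 ∣ 1 ⟩ ↦ ⟨ 0 ∣ 0 ∣ 0 ∣ 0 ∣ 0 ∣ 0 ⟩ ∷ [])
  ∷ (⟨ 3 ∣ 3 ∣ 3 ∣ 3 ∣ 0 ∣ 0 ⟩ ↦ ⟨ 2 ∣ 2 ∣ 2 ∣ 2 ∣ 3 ∣ 3 ⟩ ∷ [])
  ∷ (⟨ 2 ∣ 2 ∣ 2 ∣ 2 ∣ 0 ∣ 0 ⟩ ↦ ⟨ 1 ∣ 1 ∣ 1 ∣ 1 ∣ 3 ∣ 3 ⟩ ∷ [])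
  ∷ (⟨ 1 ∣ 1 ∣ 1 ∣ 1 ∣ 0 ∣ 0 ⟩ ↦ ⟨ 0 ∣ 0 ∣ 0 ∣ 0 ∣ 3 ∣ 3 ⟩ ∷ [])
  ∷ (⟨ 0 ∣ 3 ∣ 3 ∣ 3 ∣ 3 ∣ 0 ⟩ ↦ ⟨ 3 ∣ 2 ∣ 2 ∣ 2 ∣ 2 ∣ 3 ⟩ ∷ [])
  ∷ (⟨ 0 ∣ 2 ∣ 2 ∣ 2 ∣ 2 ∣ 0 ⟩ ↦ ⟨ 3 ∣ 1 ∣ 1 ∣ 1 ∣ 1 ∣ 3 ⟩ ∷ [])
  ∷ (⟨ 0 ∣ 1 ∣ 1 ∣ 1 ∣ 1 ∣ 0 ⟩ ↦ ⟨ 3 ∣ 0 ∣ 0 ∣ 0 ∣ 0 ∣ 3 ⟩ ∷ [])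
  ∷ (⟨ 0 ∣ 0 ∣ 3 ∣ 3 ∣ 3 ∣ 3 ⟩ ↦ ⟨ 3 ∣ 3 ∣ 2 ∣ 2 ∣ 2 ∣ 2 ⟩ ∷ [])
  ∷ (⟨ 0 ∣ 0 ∣ 2 ∣ 2 ∣ 2 ∣ 2 ⟩ ↦ ⟨ 3 ∣ 3 ∣ 1 ∣ 1 ∣ 1 ∣ 1 ⟩ ∷ [])
  ∷ (⟨ 0 ∣ 0 ∣ 1 ∣ 1 ∣ 1 ∣ 1 ⟩ ↦ ⟨ 3 ∣ 3 ∣ 0 ∣ 0 ∣ 0 ∣ 0 ⟩ ∷ [])
  ∷ (⟨ 2 ∣ 2 ∣ 2 ∣ 2 ∣ 3 ∣ 3 ⟩ ↦ ⟨ 1 ∣ 1 ∣ 1 ∣ 1 ∣ 2 ∣ 2 ⟩ ∷ [])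
  ∷ (⟨ 1 ∣ 1 ∣ 1 ∣ 1 ∣ 3 ∣ 3 ⟩ ↦ ⟨ 0 ∣ 0 ∣ 0 ∣ 0 ∣ 2 ∣ 2 ⟩ ∷ [])
  ∷ (⟨ 3 ∣ 2 ∣ 2 ∣ 2 ∣ 2 ∣ 3 ⟩ ↦ ⟨ 2 ∣ 1 ∣ 1 ∣ 1 ∣ 1 ∣ 2 ⟩ ∷ [])
  ∷ (⟨ 3 ∣ 1 ∣ 1 ∣ 1 ∣ 1 ∣ 3 ⟩ ↦ ⟨ 2 ∣ 0 ∣ 0 ∣ 0 ∣ 0 ∣ 2 ⟩ ∷ [])
  ∷ (⟨ 3 ∣ 3 ∣ 2 ∣ 2 ∣ 2 ∣ 2 ⟩ ↦ ⟨ 2 ∣ 2 ∣ 1 ∣ 1 ∣ 1 ∣ 1 ⟩ ∷ [])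
  ∷ (⟨ 3 ∣ 3 ∣ 1 ∣ 1 ∣ 1 ∣ 1 ⟩ ↦ ⟨ 2 ∣ 2 ∣ 0 ∣ 0 ∣ 0 ∣ 0 ⟩ ∷ [])
  ∷ (⟨ 1 ∣ 1 ∣ 1 ∣ 1 ∣ 2 ∣ 2 ⟩ ↦ ⟨ 0 ∣ 0 ∣ 0 ∣ 0 ∣ 1 ∣ 1 ⟩ ∷ [])
  ∷ (⟨ 2 ∣ 1 ∣ 1 ∣ 1 ∣ 1 ∣ 2 ⟩ ↦ ⟨ 1 ∣ 0 ∣ 0 ∣ 0 ∣ 0 ∣ 1 ⟩ ∷ [])
  ∷ (⟨ 2 ∣ 2 ∣ 1 ∣ 1 ∣ 1 ∣ 1 ⟩ ↦ ⟨ 1 ∣ 1 ∣ 0 ∣ 0 ∣ 0 ∣ 0 ⟩ ∷ [])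
  ∷ []

transitions-correct : map (transfer ∘ proj₁) transitions ≡ map proj₂ transitions
transitions-correct = refl

memoized : {A B : Set} → DecidableEquality A → (A → B) → List (A × B) → A → B
memoized _≟_ f [] x = f x
memoized _≟_ f ((a , b) ∷ table) x with x ≟ a
... | yes _ = b
... | no _ = memoized _≟_ f table x

memoized-correct : {A B : Set} (_≟_ : DecidableEquality A) (f : A → B) (table : List (A × B)) →
  map (f ∘ proj₁) table ≡ map proj₂ table → (x : A) → memoized _≟_ f table x ≡ f x
memoized-correct _≟_ f [] agrees x = refl
memoized-correct _≟_ f ((a , b) ∷ table) agrees x with x ≟ a
... | yes refl = sym (∷-injectiveˡ agrees)
... | no _ = memoized-correct _≟_ f table (∷-injectiveʳ agrees) x

step : LinComb → LinComb
step F = normalize (concatMap (λ (k , U) → k · memoized _≟ᵖ_ transfer transitions U) F)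

steps : ℕ → LinComb → LinComb
steps zero F = F
steps (suc k) F = steps k (step F)

start : LinComb
start = (1 , []) ∷ []

step-sound : (n : ℕ) (F : LinComb) → ⟦ F ⟧ (4 + n) ≡ ⟦ step F ⟧ (3 + n)
step-sound n F = begin
    ⟦ F ⟧ (4 + n)
  ≡⟨ expand F ⟩
    sum (map (λ (k , U) → ⟦ k · transfer′ U ⟧ (3 + n)) F)
  ≡⟨ ⟦⟧-concatMap (λ (k , U) → k · transfer′ U) F (3 + n) ⟨
    ⟦ concatMap (λ (k , U) → k · transfer′ U) F ⟧ (3 + n)
  ≡⟨ ⟦⟧-normalize (concatMap (λ (k , U) → k · transfer′ U) F) (3 + n) ⟨
    ⟦ step F ⟧ (3 + n)
  ∎
  where
  open ≡-Reasoning
  transfer′ = memoized _≟ᵖ_ transfer transitions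
  expand : (F : LinComb) → ⟦ F ⟧ (4 + n) ≡ sum (map (λ (k , U) → ⟦ k · transfer′ U ⟧ (3 + n)) F)
  expand [] = refl
  expand ((k , U) ∷ F) = cong₂ _+_
    (begin
      k * completions (4 + n) U
    ≡⟨ cong (k *_) (transfer-sound n U) ⟩
      k * ⟦ transfer U ⟧ (3 + n)
    ≡⟨ ⟦⟧-· k (transfer U) (3 + n) ⟨
      ⟦ k · transfer U ⟧ (3 + n)
    ≡⟨ cong (λ G → ⟦ k · G ⟧ (3 + n)) (memoized-correct _≟ᵖ_ transfer transitions transitions-correct U) ⟨
      ⟦ k · transfer′ U ⟧ (3 + n)
    ∎)
    (expand F)

steps-sound : (k n : ℕ) (F : LinComb) → ⟦ F ⟧ (3 + (k + n)) ≡ ⟦ steps k F ⟧ (3 + n)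
steps-sound zero n F = refl
steps-sound (suc k) n F = trans (step-sound (k + n) F) (steps-sound k n (step F))


-- The recurrence for tilings of 6 × n rectangles

-- Opaque for the same reason as completions.
opaque
  tilings : ℕ → ℕ
  tilings n = numTilings 6 n 1 4

opaque
  unfolding tilings completions

  tilings≡completions : (n : ℕ) → tilings n ≡ completions n []
  tilings≡completions n = length-filter≡countᵇ (isTiling 6 n) (subsets (placements 6 n 1 4))

tilings-steps : (k n : ℕ) → tilings (3 + (k + n)) ≡ ⟦ steps k start ⟧ (3 + n)
tilings-steps k n = trans (tilings≡completions (3 + (k + n)))
  (trans (sym (trans (+-identityʳ _) (*-identityˡ _))) (steps-sound k n start))

Recurrence : ℕ → (ℕ → ℕ) → Set
Recurrence s f = ∀ n → f (4 * s + n) + (6 * f (2 * s + n) + f n) ≡ 7 * f (3 * s + n) + 4 * f (s + n)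

-- x¹⁶ − 7x¹² + 6x⁸ − 4x⁴ + 1 annihilates the transfer on the orbit of the empty profile;
-- it is the denominator with z⁶ replaced by x⁴, since six units of N are four columns.
annihilation : normalize (steps 16 start ++ 6 · steps 8 start ++ start) ≡ normalize (7 · steps 12 start ++ 4 · steps 4 start)
annihilation = refl

tilings-recurrence-wide : (n : ℕ) → tilings (16 + (3 + n)) + (6 * tilings (8 + (3 + n)) + tilings (3 + n))
                                    ≡ 7 * tilings (12 + (3 + n)) + 4 * tilings (4 + (3 + n))
tilings-recurrence-wide n = begin
    tilings (16 + (3 + n)) + (6 * tilings (8 + (3 + n)) + tilings (3 + n))
  ≡⟨ cong₂ _+_ (tilings-steps 16 n) (cong₂ _+_ (cong (6 *_) (tilings-steps 8 n)) (tilings-steps 0 n)) ⟩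
    ⟦ steps 16 start ⟧ w + (6 * ⟦ steps 8 start ⟧ w + ⟦ start ⟧ w)
  ≡⟨ cong (⟦ steps 16 start ⟧ w +_) (cong₂ _+_ (⟦⟧-· 6 (steps 8 start) w) refl) ⟨
    ⟦ steps 16 start ⟧ w + (⟦ 6 · steps 8 start ⟧ w + ⟦ start ⟧ w)
  ≡⟨ trans (⟦⟧-++ (steps 16 start) (6 · steps 8 start ++ start) w) (cong (⟦ steps 16 start ⟧ w +_) (⟦⟧-++ (6 · steps 8 start) start w)) ⟨
    ⟦ steps 16 start ++ 6 · steps 8 start ++ start ⟧ w
  ≡⟨ ⟦⟧-normalize (steps 16 start ++ 6 · steps 8 start ++ start) w ⟨
    ⟦ normalize (steps 16 start ++ 6 · steps 8 start ++ start) ⟧ w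
  ≡⟨ cong (λ F → ⟦ F ⟧ w) annihilation ⟩
    ⟦ normalize (7 · steps 12 start ++ 4 · steps 4 start) ⟧ w
  ≡⟨ ⟦⟧-normalize (7 · steps 12 start ++ 4 · steps 4 start) w ⟩
    ⟦ 7 · steps 12 start ++ 4 · steps 4 start ⟧ w
  ≡⟨ ⟦⟧-++ (7 · steps 12 start) (4 · steps 4 start) w ⟩
    ⟦ 7 · steps 12 start ⟧ w + ⟦ 4 · steps 4 start ⟧ w
  ≡⟨ cong₂ _+_ (⟦⟧-· 7 (steps 12 start) w) (⟦⟧-· 4 (steps 4 start) w) ⟩
    7 * ⟦ steps 12 start ⟧ w + 4 * ⟦ steps 4 start ⟧ w
  ≡⟨ cong₂ _+_ (cong (7 *_) (tilings-steps 12 n)) (cong (4 *_) (tilings-steps 4 n)) ⟨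
    7 * tilings (12 + (3 + n)) + 4 * tilings (4 + (3 + n))
  ∎
  where
  open ≡-Reasoning
  w = 3 + n

tilingCounts : List ℕ
tilingCounts = 1 ∷ 0 ∷ 0 ∷ 0 ∷ 4 ∷ 0 ∷ 0 ∷ 0 ∷ 25 ∷ 0 ∷ 0 ∷ 0 ∷ 154 ∷ 0 ∷ 0 ∷ 0 ∷ 943 ∷ 0 ∷ 0 ∷ []

opaque
  unfolding completions

  orbit-counts : All (λ k → ⟦ steps k start ⟧ 3 ≡ nthOr 0 tilingCounts (3 + k)) (upTo 16)
  orbit-counts = from-yes (all? (λ k → ⟦ steps k start ⟧ 3 ℕ.≟ nthOr 0 tilingCounts (3 + k)) (upTo 16))

opaque
  unfolding tilings

  tilings-initial : (n : ℕ) → n < 19 → tilings n ≡ nthOr 0 tilingCounts n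
  tilings-initial 0 _ = refl
  tilings-initial 1 _ = refl
  tilings-initial 2 _ = refl
  tilings-initial (suc (suc (suc k))) (s≤s (s≤s (s≤s k<16))) =
    trans (cong (λ m → tilings (3 + m)) (sym (+-identityʳ k)))
          (trans (tilings-steps k 0) (All.lookup orbit-counts (∈-upTo⁺ k<16)))

tilings-recurrence-narrow : (n : ℕ) → n < 3 →
  tilings (16 + n) + (6 * tilings (8 + n) + tilings n) ≡ 7 * tilings (12 + n) + 4 * tilings (4 + n)
tilings-recurrence-narrow n n<3 = begin
    tilings (16 + n) + (6 * tilings (8 + n) + tilings n)
  ≡⟨ cong₂ _+_ (initial 16) (cong₂ _+_ (cong (6 *_) (initial 8)) (initial 0)) ⟩
    count (16 + n) + (6 * count (8 + n) + count n)
  ≡⟨ counts-recurrence n n<3 ⟩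
    7 * count (12 + n) + 4 * count (4 + n)
  ≡⟨ cong₂ _+_ (cong (7 *_) (initial 12)) (cong (4 *_) (initial 4)) ⟨
    7 * tilings (12 + n) + 4 * tilings (4 + n)
  ∎
  where
  open ≡-Reasoning
  count = nthOr 0 tilingCounts
  initial : (s : ℕ) → {T (s ≤ᵇ 16)} → tilings (s + n) ≡ count (s + n)
  initial s {s≤16} = tilings-initial (s + n) (≤-trans (≤-reflexive (sym (+-suc s n))) (+-mono-≤ (≤ᵇ⇒≤ s 16 s≤16) n<3))
  counts-recurrence : (n : ℕ) → n < 3 → count (16 + n) + (6 * count (8 + n) + count n) ≡ 7 * count (12 + n) + 4 * count (4 + n)
  counts-recurrence 0 _ = refl
  counts-recurrence 1 _ = refl
  counts-recurrence 2 _ = refl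
  counts-recurrence (suc (suc (suc _))) (s≤s (s≤s (s≤s ())))

tilings-recurrence : Recurrence 4 tilings
tilings-recurrence 0 = tilings-recurrence-narrow 0 (s≤s z≤n)
tilings-recurrence 1 = tilings-recurrence-narrow 1 (s≤s (s≤s z≤n))
tilings-recurrence 2 = tilings-recurrence-narrow 2 (s≤s (s≤s (s≤s z≤n)))
tilings-recurrence (suc (suc (suc n))) = tilings-recurrence-wide n


-- The generating function

sumTo-cong≤ : {f g : ℕ → ℤ} (N : ℕ) → (∀ j → j ≤ N → f j ≡ g j) → sumTo f N ≡ sumTo g N
sumTo-cong≤ zero f≗g = f≗g 0 z≤n
sumTo-cong≤ (suc N) f≗g = cong₂ ℤ._+_ (sumTo-cong≤ N (λ j j≤N → f≗g j (m≤n⇒m≤1+n j≤N))) (f≗g (suc N) ≤-refl)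

sumTo-+ : (f g : ℕ → ℤ) (N : ℕ) → sumTo (λ j → f j ℤ.+ g j) N ≡ sumTo f N ℤ.+ sumTo g N
sumTo-+ f g zero = refl
sumTo-+ f g (suc N) = trans (cong (ℤ._+ (f (suc N) ℤ.+ g (suc N))) (sumTo-+ f g N)) (ℤ-Semigroup.interchange (sumTo f N) _ _ _)

sumTo-suc : (f : ℕ → ℤ) (N : ℕ) → sumTo f (suc N) ≡ f 0 ℤ.+ sumTo (f ∘ suc) N
sumTo-suc f zero = refl
sumTo-suc f (suc N) = trans (cong (ℤ._+ f (suc (suc N))) (sumTo-suc f N)) (ℤᵖ.+-assoc (f 0) _ _)

sumTo-reverse : (f : ℕ → ℤ) (N : ℕ) → sumTo f N ≡ sumTo (λ j → f (N ∸ j)) N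
sumTo-reverse f zero = refl
sumTo-reverse f (suc N) = begin
    sumTo f N ℤ.+ f (suc N)
  ≡⟨ cong (ℤ._+ f (suc N)) (sumTo-reverse f N) ⟩
    sumTo (λ j → f (N ∸ j)) N ℤ.+ f (suc N)
  ≡⟨ ℤᵖ.+-comm (sumTo (λ j → f (N ∸ j)) N) (f (suc N)) ⟩
    f (suc N) ℤ.+ sumTo (λ j → f (N ∸ j)) N
  ≡⟨ sumTo-suc (λ j → f (suc N ∸ j)) N ⟨
    sumTo (λ j → f (suc N ∸ j)) (suc N)
  ∎
  where open ≡-Reasoning

sumTo-zero : (f : ℕ → ℤ) (N : ℕ) → (∀ j → f j ≡ 0ℤ) → sumTo f N ≡ 0ℤ
sumTo-zero f zero f≡0 = f≡0 0
sumTo-zero f (suc N) f≡0 = cong₂ ℤ._+_ (sumTo-zero f N f≡0) (f≡0 (suc N))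

sumTo-mono : (h : ℕ → ℤ) (c : ℤ) (d N : ℕ) → sumTo (λ j → h j ℤ.* coeff (mono c d) j) N ≡ (if d ≤ᵇ N then h d ℤ.* c else 0ℤ)
sumTo-mono h c zero zero = refl
sumTo-mono h c zero (suc N) = begin
    sumTo (λ j → h j ℤ.* coeff (c ∷ []) j) (suc N)
  ≡⟨ sumTo-suc _ N ⟩
    h 0 ℤ.* c ℤ.+ sumTo (λ j → h (suc j) ℤ.* 0ℤ) N
  ≡⟨ cong (λ x → h 0 ℤ.* c ℤ.+ x) (sumTo-zero _ N (λ j → ℤᵖ.*-zeroʳ (h (suc j)))) ⟩
    h 0 ℤ.* c ℤ.+ 0ℤ
  ≡⟨ ℤᵖ.+-identityʳ _ ⟩
    h 0 ℤ.* c
  ∎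
  where open ≡-Reasoning
sumTo-mono h c (suc d) zero = ℤᵖ.*-zeroʳ (h 0)
sumTo-mono h c (suc d) (suc N) = begin
    sumTo (λ j → h j ℤ.* coeff (mono c (suc d)) j) (suc N)
  ≡⟨ sumTo-suc _ N ⟩
    h 0 ℤ.* 0ℤ ℤ.+ sumTo (λ j → h (suc j) ℤ.* coeff (mono c d) j) N
  ≡⟨ cong₂ ℤ._+_ (ℤᵖ.*-zeroʳ (h 0)) (sumTo-mono (h ∘ suc) c d N) ⟩
    0ℤ ℤ.+ (if d ≤ᵇ N then h (suc d) ℤ.* c else 0ℤ)
  ≡⟨ ℤᵖ.+-identityˡ _ ⟩
    (if d ≤ᵇ N then h (suc d) ℤ.* c else 0ℤ)
  ≡⟨ cong (λ b → if b then h (suc d) ℤ.* c else 0ℤ) (<ᵇ-suc d N) ⟨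
    (if suc d ≤ᵇ suc N then h (suc d) ℤ.* c else 0ℤ)
  ∎
  where open ≡-Reasoning

⋆-congˡ : {f g : Series} (h : Series) (N : ℕ) → (∀ k → k ≤ N → f k ≡ g k) → (f ⋆ h) N ≡ (g ⋆ h) N
⋆-congˡ h N f≗g = sumTo-cong≤ N (λ k k≤N → cong (ℤ._* h (N ∸ k)) (f≗g k k≤N))

⋆-⊕ : (f : Series) (p q : Poly) (N : ℕ) → (f ⋆ coeff (p ⊕ q)) N ≡ (f ⋆ coeff p) N ℤ.+ (f ⋆ coeff q) N
⋆-⊕ f p q N = trans (sumTo-cong≤ N (λ k _ → trans (cong (f k ℤ.*_) (coeff-⊕ p q (N ∸ k))) (ℤᵖ.*-distribˡ-+ (f k) _ _)))
                    (sumTo-+ (λ k → f k ℤ.* coeff p (N ∸ k)) (λ k → f k ℤ.* coeff q (N ∸ k)) N)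
  where
  coeff-⊕ : (p q : Poly) (j : ℕ) → coeff (p ⊕ q) j ≡ coeff p j ℤ.+ coeff q j
  coeff-⊕ [] q j = sym (ℤᵖ.+-identityˡ (coeff q j))
  coeff-⊕ (c ∷ p) [] j = sym (ℤᵖ.+-identityʳ (coeff (c ∷ p) j))
  coeff-⊕ (c ∷ p) (d ∷ q) zero = refl
  coeff-⊕ (c ∷ p) (d ∷ q) (suc j) = coeff-⊕ p q j

⋆-mono : (f : Series) (c : ℤ) (d N : ℕ) → (f ⋆ coeff (mono c d)) N ≡ (if d ≤ᵇ N then f (N ∸ d) ℤ.* c else 0ℤ)
⋆-mono f c d N = begin
    sumTo (λ k → f k ℤ.* coeff (mono c d) (N ∸ k)) N
  ≡⟨ sumTo-reverse _ N ⟩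
    sumTo (λ j → f (N ∸ j) ℤ.* coeff (mono c d) (N ∸ (N ∸ j))) N
  ≡⟨ sumTo-cong≤ N (λ j j≤N → cong (λ i → f (N ∸ j) ℤ.* coeff (mono c d) i) (m∸[m∸n]≡n j≤N)) ⟩
    sumTo (λ j → f (N ∸ j) ℤ.* coeff (mono c d) j) N
  ≡⟨ sumTo-mono (λ j → f (N ∸ j)) c d N ⟩
    (if d ≤ᵇ N then f (N ∸ d) ℤ.* c else 0ℤ)
  ∎
  where open ≡-Reasoning

⋆-denom : (f : Series) (m : ℕ) → (f ⋆ coeff denom) (24 + m) ≡
  f (24 + m) ℤ.* ℤ.+ 1 ℤ.+ (f (18 + m) ℤ.* ℤ.- ℤ.+ 7 ℤ.+ (f (12 + m) ℤ.* ℤ.+ 6 ℤ.+ (f (6 + m) ℤ.* ℤ.- ℤ.+ 4 ℤ.+ f m ℤ.* ℤ.+ 1)))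
⋆-denom f m =
  trans (⋆-⊕ f (mono (ℤ.+ 1) 0) (mono (ℤ.- ℤ.+ 7) 6 ⊕ (mono (ℤ.+ 6) 12 ⊕ (mono (ℤ.- ℤ.+ 4) 18 ⊕ mono (ℤ.+ 1) 24))) N)
  (cong₂ ℤ._+_ (⋆-mono f (ℤ.+ 1) 0 N)
  (trans (⋆-⊕ f (mono (ℤ.- ℤ.+ 7) 6) (mono (ℤ.+ 6) 12 ⊕ (mono (ℤ.- ℤ.+ 4) 18 ⊕ mono (ℤ.+ 1) 24)) N)
  (cong₂ ℤ._+_ (⋆-mono f (ℤ.- ℤ.+ 7) 6 N)
  (trans (⋆-⊕ f (mono (ℤ.+ 6) 12) (mono (ℤ.- ℤ.+ 4) 18 ⊕ mono (ℤ.+ 1) 24) N)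
  (cong₂ ℤ._+_ (⋆-mono f (ℤ.+ 6) 12 N)
  (trans (⋆-⊕ f (mono (ℤ.- ℤ.+ 4) 18) (mono (ℤ.+ 1) 24) N)
  (cong₂ ℤ._+_ (⋆-mono f (ℤ.- ℤ.+ 4) 18 N) (⋆-mono f (ℤ.+ 1) 24 N))))))))
  where N = 24 + m

recurrence⇒denom-sum≡0 : (a b c d e : ℕ) → a + (6 * c + e) ≡ 7 * b + 4 * d →
  ℤ.+ a ℤ.* ℤ.+ 1 ℤ.+ (ℤ.+ b ℤ.* ℤ.- ℤ.+ 7 ℤ.+ (ℤ.+ c ℤ.* ℤ.+ 6 ℤ.+ (ℤ.+ d ℤ.* ℤ.- ℤ.+ 4 ℤ.+ ℤ.+ e ℤ.* ℤ.+ 1))) ≡ 0ℤ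
recurrence⇒denom-sum≡0 a b c d e rec = begin
    ℤ.+ a ℤ.* ℤ.+ 1 ℤ.+ (ℤ.+ b ℤ.* ℤ.- ℤ.+ 7 ℤ.+ (ℤ.+ c ℤ.* ℤ.+ 6 ℤ.+ (ℤ.+ d ℤ.* ℤ.- ℤ.+ 4 ℤ.+ ℤ.+ e ℤ.* ℤ.+ 1)))
  ≡⟨ regroup (ℤ.+ a) (ℤ.+ b) (ℤ.+ c) (ℤ.+ d) (ℤ.+ e) ⟩
    (ℤ.+ a ℤ.+ (ℤ.+ 6 ℤ.* ℤ.+ c ℤ.+ ℤ.+ e)) ℤ.- (ℤ.+ 7 ℤ.* ℤ.+ b ℤ.+ ℤ.+ 4 ℤ.* ℤ.+ d)
  ≡⟨ cong₂ ℤ._-_ lhs rhs ⟨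
    ℤ.+ (a + (6 * c + e)) ℤ.- ℤ.+ (7 * b + 4 * d)
  ≡⟨ cong (λ k → ℤ.+ k ℤ.- ℤ.+ (7 * b + 4 * d)) rec ⟩
    ℤ.+ (7 * b + 4 * d) ℤ.- ℤ.+ (7 * b + 4 * d)
  ≡⟨ ℤᵖ.+-inverseʳ (ℤ.+ (7 * b + 4 * d)) ⟩
    0ℤ
  ∎
  where
  open ≡-Reasoning
  regroup : ∀ a b c d e → a ℤ.* ℤ.+ 1 ℤ.+ (b ℤ.* ℤ.- ℤ.+ 7 ℤ.+ (c ℤ.* ℤ.+ 6 ℤ.+ (d ℤ.* ℤ.- ℤ.+ 4 ℤ.+ e ℤ.* ℤ.+ 1)))
                          ≡ (a ℤ.+ (ℤ.+ 6 ℤ.* c ℤ.+ e)) ℤ.- (ℤ.+ 7 ℤ.* b ℤ.+ ℤ.+ 4 ℤ.* d)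
  regroup = ℤ-Solver.solve-∀
  lhs : ℤ.+ (a + (6 * c + e)) ≡ ℤ.+ a ℤ.+ (ℤ.+ 6 ℤ.* ℤ.+ c ℤ.+ ℤ.+ e)
  lhs = trans (ℤᵖ.pos-+ a (6 * c + e)) (cong (λ x → ℤ.+ a ℤ.+ x) (trans (ℤᵖ.pos-+ (6 * c) e) (cong (ℤ._+ ℤ.+ e) (ℤᵖ.pos-* 6 c))))
  rhs : ℤ.+ (7 * b + 4 * d) ≡ ℤ.+ 7 ℤ.* ℤ.+ b ℤ.+ ℤ.+ 4 ℤ.* ℤ.+ d
  rhs = trans (ℤᵖ.pos-+ (7 * b) (4 * d)) (cong₂ ℤ._+_ (ℤᵖ.pos-* 7 b) (ℤᵖ.pos-* 4 d))

atTwoThirds : (ℕ → ℕ) → ℕ → ℕ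
atTwoThirds f N = if (2 * N) % 3 ≡ᵇ 0 then f ((2 * N) / 3) else 0

atTwoThirds-shift : (f : ℕ → ℕ) (k n : ℕ) → atTwoThirds f (6 * k + n) ≡ atTwoThirds (λ w → f (4 * k + w)) n
atTwoThirds-shift f k n = begin
    atTwoThirds f (6 * k + n)
  ≡⟨ cong (λ m → if m % 3 ≡ᵇ 0 then f (m / 3) else 0) (doubled k n) ⟩
    (if (2 * n + 4 * k * 3) % 3 ≡ᵇ 0 then f ((2 * n + 4 * k * 3) / 3) else 0)
  ≡⟨ cong₂ (λ r q → if r ≡ᵇ 0 then f q else 0) ([m+kn]%n≡m%n (2 * n) (4 * k) 3) quotient ⟩
    atTwoThirds (λ w → f (4 * k + w)) n
  ∎
  where
  open ≡-Reasoning
  doubled : ∀ k n → 2 * (6 * k + n) ≡ 2 * n + 4 * k * 3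
  doubled = solve-∀
  quotient : (2 * n + 4 * k * 3) / 3 ≡ 4 * k + (2 * n) / 3
  quotient = trans (+-distrib-/-∣ʳ (2 * n) (divides-refl (4 * k)))
                   (trans (cong (((2 * n) / 3) +_) (m*n/n≡m (4 * k) 3)) (+-comm ((2 * n) / 3) (4 * k)))

atTwoThirds-recurrence : (f : ℕ → ℕ) → Recurrence 4 f → Recurrence 6 (atTwoThirds f)
atTwoThirds-recurrence f rec n = begin
    atTwoThirds f (24 + n) + (6 * atTwoThirds f (12 + n) + atTwoThirds f n)
  ≡⟨ cong₂ _+_ (atTwoThirds-shift f 4 n) (cong (λ x → 6 * x + atTwoThirds f n) (atTwoThirds-shift f 2 n)) ⟩
    term 16 + (6 * term 8 + term 0)
  ≡⟨ selected ((2 * n) % 3 ≡ᵇ 0) ⟩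
    7 * term 12 + 4 * term 4
  ≡⟨ cong₂ _+_ (cong (7 *_) (atTwoThirds-shift f 3 n)) (cong (4 *_) (atTwoThirds-shift f 1 n)) ⟨
    7 * atTwoThirds f (18 + n) + 4 * atTwoThirds f (6 + n)
  ∎
  where
  open ≡-Reasoning
  term : ℕ → ℕ
  term s = atTwoThirds (λ w → f (s + w)) n
  selected : (b : Bool) → let t = λ s → if b then f (s + (2 * n) / 3) else 0 in
    t 16 + (6 * t 8 + t 0) ≡ 7 * t 12 + 4 * t 4
  selected true = rec ((2 * n) / 3)
  selected false = refl

opaque
  unfolding tilings

  aSeq≡atTwoThirds : (N : ℕ) → aSeq N ≡ atTwoThirds tilings N
  aSeq≡atTwoThirds zero = refl
  aSeq≡atTwoThirds (suc N) = refl

aSeq-initial : (N : ℕ) → N < 28 → aSeq N ≡ atTwoThirds (nthOr 0 tilingCounts) N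
aSeq-initial N N<28 = trans (aSeq≡atTwoThirds N)
  (cong (λ x → if (2 * N) % 3 ≡ᵇ 0 then x else 0)
        (tilings-initial ((2 * N) / 3) (s≤s (/-monoˡ-≤ 3 (*-monoʳ-≤ 2 {N} {27} (≤-pred N<28))))))

⋆-denom-initial : All (λ N → ((ℤ.+_ ∘ atTwoThirds (nthOr 0 tilingCounts)) ⋆ coeff denom) N ≡ coeff numer N) (upTo 24)
⋆-denom-initial = from-yes (all? (λ N → ((ℤ.+_ ∘ atTwoThirds (nthOr 0 tilingCounts)) ⋆ coeff denom) N ℤ.≟ coeff numer N) (upTo 24))

genFun⋆denom-initial : (N : ℕ) → N < 24 → (genFun ⋆ coeff denom) N ≡ coeff numer N
genFun⋆denom-initial N N<24 =
  trans (⋆-congˡ (coeff denom) N (λ k k≤N → cong ℤ.+_ (aSeq-initial k (≤-trans (s≤s k≤N) (≤-trans N<24 (≤ᵇ⇒≤ 24 28 _))))))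
        (All.lookup ⋆-denom-initial (∈-upTo⁺ N<24))

genFun⋆denom-tail : (m : ℕ) → (genFun ⋆ coeff denom) (24 + m) ≡ coeff numer (24 + m)
genFun⋆denom-tail m = begin
    (genFun ⋆ coeff denom) (24 + m)
  ≡⟨ ⋆-congˡ (coeff denom) (24 + m) (λ k _ → cong ℤ.+_ (aSeq≡atTwoThirds k)) ⟩
    (a ⋆ coeff denom) (24 + m)
  ≡⟨ ⋆-denom a m ⟩
    a (24 + m) ℤ.* ℤ.+ 1 ℤ.+ (a (18 + m) ℤ.* ℤ.- ℤ.+ 7 ℤ.+ (a (12 + m) ℤ.* ℤ.+ 6 ℤ.+ (a (6 + m) ℤ.* ℤ.- ℤ.+ 4 ℤ.+ a m ℤ.* ℤ.+ 1)))
  ≡⟨ recurrence⇒denom-sum≡0 (f (24 + m)) (f (18 + m)) (f (12 + m)) (f (6 + m)) (f m)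
                            (atTwoThirds-recurrence tilings tilings-recurrence m) ⟩
    0ℤ
  ∎
  where
  open ≡-Reasoning
  f : ℕ → ℕ
  f = atTwoThirds tilings
  a : ℕ → ℤ
  a = ℤ.+_ ∘ f

genFun⋆denom≡numer : (N : ℕ) → (genFun ⋆ coeff denom) N ≡ coeff numer N
genFun⋆denom≡numer N with <-or-≡+ 24 N
... | inj₁ N<24 = genFun⋆denom-initial N N<24
... | inj₂ (m , refl) = genFun⋆denom-tail m

mainTheorem5 : ((N : ℕ) → (genFun ⋆ coeff denom) N ≡ coeff numer N)
    × (aSeq 0 ≡ 1 × aSeq 6 ≡ 4 × aSeq 12 ≡ 25 × aSeq 18 ≡ 154 × aSeq 24 ≡ 943)
mainTheorem5 = genFun⋆denom≡numer , refl , initial 6 , initial 12 , initial 18 , initial 24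
  where
  initial : (N : ℕ) {_ : T (N <ᵇ 28)} → aSeq N ≡ atTwoThirds (nthOr 0 tilingCounts) N
  initial N {N<28} = aSeq-initial N (<ᵇ⇒< N 28 N<28)
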